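{- If $G$ is a finite simple graph of order $n$, then \[ \alpha_1(L(G)) \leq \frac{2n}{3}, \] and this bound is sharp.
   Context: $\alpha_1(H)$ is the maximum cardinality of a set $S \subseteq V(H)$ whose induced subgraph has maximum degree at most $1$. $L(G)$ is the line graph of $G$. -}

module Defs where

open import Data.Nat using (ℕ; _≤_)
open import Data.Fin using (Fin; _<_)
open import Data.Bool using (Bool; true; false; T)
open import Data.Product using (Σ; Σ-syntax; _×_; _,_; proj₁; proj₂; ∃)
open import Data.Sum using (_⊎_; inj₁; inj₂)
open import Data.List using (List; length)
open import Data.List.Membership.Propositional using (_∈_)
open import Data.List.Relation.Unary.Unique.Propositional using (Unique)
open import Relation.Binary.PropositionalEquality using (_≡_; refl) renaming (sym to ≡-sym)
open import Relation.Nullary using (¬_)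

record Graph : Set₁ where
  field
    V          : Set
    Adj        : V → V → Set
    Adj-sym    : ∀ {u v} → Adj u v → Adj v u
    Adj-irrefl : ∀ v → ¬ Adj v v
open Graph public

record SimpleGraph (n : ℕ) : Set where
  field
    adj    : Fin n → Fin n → Bool
    sym    : ∀ i j → adj i j ≡ adj j i
    irrefl : ∀ i → adj i i ≡ false
open SimpleGraph public

-- Edges of G, each represented once as an ordered pair (i , j) with i < j.
Edge : ∀ {n} → SimpleGraph n → Set
Edge {n} G = Σ[ i ∈ Fin n ] Σ[ j ∈ Fin n ] (i < j × T (adj G i j))

src tgt : ∀ {n} (G : SimpleGraph n) → Edge G → Fin n
src G e = proj₁ e
tgt G e = proj₁ (proj₂ e)

ShareEnd : ∀ {n} (G : SimpleGraph n) → Edge G → Edge G → Set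
ShareEnd G e f = (src G e ≡ src G f ⊎ src G e ≡ tgt G f) ⊎ (tgt G e ≡ src G f ⊎ tgt G e ≡ tgt G f)

swapSh : ∀ {n} (G : SimpleGraph n) {e f : Edge G} → ShareEnd G e f → ShareEnd G f e
swapSh G (inj₁ (inj₁ p)) = inj₁ (inj₁ (≡-sym p))
swapSh G (inj₁ (inj₂ p)) = inj₂ (inj₁ (≡-sym p))
swapSh G (inj₂ (inj₁ p)) = inj₁ (inj₂ (≡-sym p))
swapSh G (inj₂ (inj₂ p)) = inj₂ (inj₂ (≡-sym p))

LineGraph : ∀ {n} → SimpleGraph n → Graph
LineGraph G = record
  { V = Edge G
  ; Adj = λ e f → ¬ (e ≡ f) × ShareEnd G e f
  ; Adj-sym = λ { {e} {f} (ne , sh) → (λ q → ne (≡-sym q)) , swapSh G {e} {f} sh }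
  ; Adj-irrefl = λ v p → proj₁ p refl
  }

MaxDeg≤1 : (H : Graph) → List (V H) → Set
MaxDeg≤1 H S = ∀ v → v ∈ S → ∀ u w → u ∈ S → w ∈ S →
               Adj H v u → Adj H v w → u ≡ w

IsAlpha1 : Graph → ℕ → Set
IsAlpha1 H m =
  (Σ[ S ∈ List (V H) ] (Unique S × MaxDeg≤1 H S × length S ≡ m)) ×
  (∀ (S : List (V H)) → Unique S → MaxDeg≤1 H S → length S ≤ m)

{-# OPTIONS --safe #-}
-- Let S be a set of edges in which every edge touches at most one other edge of S, and let
-- d v be the number of edges of S at v. Every vertex v sends weight (d v) to each of its
-- d v edges, where weight 1 = 2, weight 2 = 1 and weight d = 0 otherwise, so v sends at most 2
-- in total. An edge uv of S has d u , d v ≥ 1 and d u + d v ≤ 3, since only one further edge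
-- of S touches it, so it receives at least 3. Hence 3 |S| ≤ 2 n. Equality holds for k disjoint
-- copies of the path P₃ with all their 2 k edges.
module Submission where

open import Defs
open import Data.Bool using (Bool; false; T; _∧_; _∨_)
open import Data.Bool.Properties using (∨-comm; ∧-zeroʳ; T-irrelevant)
open import Data.Empty using (⊥; ⊥-elim)
open import Data.Fin using (Fin; zero; suc; toℕ; _<_; combine; remQuot)
open import Data.Fin.Properties using (_≟_; <-irrelevant; <-irrefl; <-asym; combine-injective; combine-monoˡ-<; remQuot-combine)
open import Data.List using (List; []; _∷_; _++_; map; length; allFin; cartesianProductWith)
open import Data.List.Properties using (length-map; length-++; length-tabulate; map-cong)
open import Data.List.Membership.Propositional using (_∈_)
open import Data.List.Membership.Propositional.Properties using (∈-allFin; ∈-cartesianProductWith⁻)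
open import Data.List.Relation.Unary.All using (lookup; []; _∷_)
open import Data.List.Relation.Unary.Any using (here; there)
open import Data.List.Relation.Unary.Unique.Propositional using (Unique; []; _∷_)
open import Data.List.Relation.Unary.Unique.Propositional.Properties using (allFin⁺; cartesianProductWith⁺)
open import Data.Nat using (ℕ; zero; suc; _+_; _*_; _≤_; z≤n; s≤s)
open import Data.Nat.ListAction using (sum)
open import Data.Nat.Properties using (≤-refl; ≤-reflexive; ≤-trans; ≤-antisym; +-mono-≤; +-identityʳ; *-identityˡ; *-zeroʳ; *-suc; *-assoc; *-distribʳ-+; *-cancelˡ-≤; m≤m+n; m≤n+m; n≤0⇒n≡0; m+1+n≢0; 1+n≢n; +-commutativeSemigroup; module ≤-Reasoning)
import Data.Nat.Properties as ℕ
open import Algebra.Properties.CommutativeSemigroup +-commutativeSemigroup using (interchange)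
open import Data.Product using (Σ; _×_; _,_; proj₁; proj₂)
open import Data.Sum using (_⊎_; inj₁; inj₂; [_,_]′)
import Data.Sum as Sum
open import Function using (_∘_; id)
open import Relation.Binary.Definitions using (DecidableEquality)
open import Relation.Binary.PropositionalEquality using (_≡_; _≢_; refl; trans; cong; cong₂; subst; module ≡-Reasoning) renaming (sym to ≡-sym)
open import Relation.Nullary using (does; yes; no)
open import Relation.Nullary.Decidable using (dec-true; dec-false; decidable-stable)

∑ : {A : Set} → List A → (A → ℕ) → ℕ
∑ xs f = sum (map f xs)

infix 5 ∑
syntax ∑ xs (λ x → t) = ∑[ x ∈ xs ] t

module _ {A : Set} where

  ∑-cong : (xs : List A) {f g : A → ℕ} → (∀ x → f x ≡ g x) → ∑ xs f ≡ ∑ xs g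
  ∑-cong xs f≗g = cong sum (map-cong f≗g xs)

  ∑-distrib-+ : (xs : List A) (f g : A → ℕ) → ∑[ x ∈ xs ] f x + g x ≡ ∑ xs f + ∑ xs g
  ∑-distrib-+ []       f g = refl
  ∑-distrib-+ (x ∷ xs) f g =
    trans (cong (f x + g x +_) (∑-distrib-+ xs f g)) (interchange (f x) (g x) (∑ xs f) (∑ xs g))

  ∑-const : (xs : List A) (c : ℕ) → ∑[ x ∈ xs ] c ≡ c * length xs
  ∑-const []       c = ≡-sym (*-zeroʳ c)
  ∑-const (x ∷ xs) c = trans (cong (c +_) (∑-const xs c)) (≡-sym (*-suc c (length xs)))

  ∑-mono-≤ : (xs : List A) {f g : A → ℕ} → (∀ {x} → x ∈ xs → f x ≤ g x) → ∑ xs f ≤ ∑ xs g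
  ∑-mono-≤ []       f≤g = z≤n
  ∑-mono-≤ (x ∷ xs) f≤g = +-mono-≤ (f≤g (here refl)) (∑-mono-≤ xs (f≤g ∘ there))

  ∑-≡0 : (xs : List A) {f : A → ℕ} → (∀ {x} → x ∈ xs → f x ≡ 0) → ∑ xs f ≡ 0
  ∑-≡0 xs f≡0 = ≤-antisym (≤-trans (∑-mono-≤ xs (≤-reflexive ∘ f≡0)) (≤-reflexive (∑-const xs 0))) z≤n

  ∈⇒≤∑ : {xs : List A} (f : A → ℕ) {x : A} → x ∈ xs → f x ≤ ∑ xs f
  ∈⇒≤∑ {y ∷ xs} f (here refl) = m≤m+n (f y) (∑ xs f)
  ∈⇒≤∑ {y ∷ xs} f (there x∈) = ≤-trans (∈⇒≤∑ f x∈) (m≤n+m (∑ xs f) (f y))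

  ∑-≤-subsingleton : {xs : List A} {f : A → ℕ} {K : ℕ} → Unique xs →
                     (∀ {x} → x ∈ xs → f x ≤ K) →
                     (∀ {x y} → x ∈ xs → y ∈ xs → f x ≢ 0 → f y ≢ 0 → x ≡ y) →
                     ∑ xs f ≤ K
  ∑-≤-subsingleton {[]}     _ _ _ = z≤n
  ∑-≤-subsingleton {x ∷ xs} {f} {K} (x∉xs ∷ xs!) f≤K supp with f x ℕ.≟ 0
  ... | yes fx≡0 rewrite fx≡0 =
    ∑-≤-subsingleton xs! (f≤K ∘ there) (λ x∈ y∈ → supp (there x∈) (there y∈))
  ... | no fx≢0 = begin
      f x + ∑ xs f  ≡⟨ cong (f x +_) (∑-≡0 xs rest≡0) ⟩
      f x + 0       ≡⟨ +-identityʳ (f x) ⟩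
      f x           ≤⟨ f≤K (here refl) ⟩
      K             ∎
    where
    open ≤-Reasoning
    rest≡0 : ∀ {y} → y ∈ xs → f y ≡ 0
    rest≡0 {y} y∈ = decidable-stable (f y ℕ.≟ 0)
      (λ fy≢0 → lookup x∉xs y∈ (supp (here refl) (there y∈) fx≢0 fy≢0))

length-cartesianProductWith : {A B C : Set} (f : A → B → C) (xs : List A) (ys : List B) →
                              length (cartesianProductWith f xs ys) ≡ length xs * length ys
length-cartesianProductWith f []       ys = refl
length-cartesianProductWith f (x ∷ xs) ys = begin
    length (map (f x) ys ++ cartesianProductWith f xs ys)           ≡⟨ length-++ (map (f x) ys) ⟩
    length (map (f x) ys) + length (cartesianProductWith f xs ys)  ≡⟨ cong₂ _+_ (length-map (f x) ys) (length-cartesianProductWith f xs ys) ⟩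
    length ys + length xs * length ys                               ∎
  where open ≡-Reasoning

m+n≢0⇒m≢0⊎n≢0 : ∀ m {n} → m + n ≢ 0 → m ≢ 0 ⊎ n ≢ 0
m+n≢0⇒m≢0⊎n≢0 zero    n≢0 = inj₂ n≢0
m+n≢0⇒m≢0⊎n≢0 (suc m) _   = inj₁ (λ ())

m+n≤1 : ∀ {m n} → m ≤ 1 → n ≤ 1 → (m ≢ 0 → n ≢ 0 → ⊥) → m + n ≤ 1
m+n≤1 {zero}                _ n≤1 _    = n≤1
m+n≤1 {suc zero}    {zero}  _ _   _    = ≤-refl
m+n≤1 {suc zero}    {suc n} _ _   both = ⊥-elim (both (λ ()) (λ ()))
m+n≤1 {suc (suc m)} (s≤s ())

does-≟-comm : ∀ {n} (u v : Fin n) → does (u ≟ v) ≡ does (v ≟ u)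
does-≟-comm u v with u ≟ v
... | yes u≡v = ≡-sym (dec-true (v ≟ u) (≡-sym u≡v))
... | no  u≢v = ≡-sym (dec-false (v ≟ u) (u≢v ∘ ≡-sym))

δ : ∀ {n} → Fin n → Fin n → ℕ
δ u v with u ≟ v
... | yes _ = 1
... | no  _ = 0

module _ {n : ℕ} where

  δ-refl : (u : Fin n) → δ u u ≡ 1
  δ-refl u with u ≟ u
  ... | yes _   = refl
  ... | no  u≢u = ⊥-elim (u≢u refl)

  δ-≢ : {u v : Fin n} → u ≢ v → δ u v ≡ 0
  δ-≢ {u} {v} u≢v with u ≟ v
  ... | yes u≡v = ⊥-elim (u≢v u≡v)
  ... | no  _   = refl

  δ≢0⇒≡ : {u v : Fin n} → δ u v ≢ 0 → u ≡ v
  δ≢0⇒≡ {u} {v} δ≢0 with u ≟ v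
  ... | yes u≡v = u≡v
  ... | no  _   = ⊥-elim (δ≢0 refl)

  δ≤1 : (u v : Fin n) → δ u v ≤ 1
  δ≤1 u v with u ≟ v
  ... | yes _ = ≤-refl
  ... | no  _ = z≤n

  δ+δ≤1 : {a b : Fin n} (v : Fin n) → a ≢ b → δ v a + δ v b ≤ 1
  δ+δ≤1 v a≢b = m+n≤1 (δ≤1 v _) (δ≤1 v _) (λ va vb → a≢b (trans (≡-sym (δ≢0⇒≡ va)) (δ≢0⇒≡ vb)))

  ∑-δ : {vs : List (Fin n)} (H : Fin n → ℕ) {a : Fin n} → Unique vs → a ∈ vs →
        ∑[ v ∈ vs ] δ v a * H v ≡ H a
  ∑-δ {vs} H {a} vs! a∈vs = ≤-antisym
      (∑-≤-subsingleton vs! (λ {v} _ → δ*H≤ v) (λ _ _ p q → trans (at-a p) (≡-sym (at-a q))))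
      (subst (_≤ ∑[ v ∈ vs ] δ v a * H v) δ*H-at-a (∈⇒≤∑ (λ v → δ v a * H v) a∈vs))
    where
    δ*H-at-a : δ a a * H a ≡ H a
    δ*H-at-a = trans (cong (_* H a) (δ-refl a)) (*-identityˡ (H a))
    δ*H≤ : ∀ v → δ v a * H v ≤ H a
    δ*H≤ v with v ≟ a
    ... | yes refl = ≤-reflexive (*-identityˡ (H v))
    ... | no  _    = z≤n
    at-a : ∀ {v} → δ v a * H v ≢ 0 → v ≡ a
    at-a {v} ≢0 = δ≢0⇒≡ (λ δ≡0 → ≢0 (cong (_* H v) δ≡0))

  ordered-pair-≡ : {a b s t : Fin n} → a < b → s < t →
                   a ≡ s ⊎ a ≡ t → b ≡ s ⊎ b ≡ t → a ≡ s × b ≡ t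
  ordered-pair-≡ a<b _   (inj₁ refl) (inj₁ refl) = ⊥-elim (<-irrefl refl a<b)
  ordered-pair-≡ _   _   (inj₁ a≡s)  (inj₂ b≡t)  = a≡s , b≡t
  ordered-pair-≡ a<b s<t (inj₂ refl) (inj₁ refl) = ⊥-elim (<-asym a<b s<t)
  ordered-pair-≡ a<b _   (inj₂ refl) (inj₂ refl) = ⊥-elim (<-irrefl refl a<b)

weight : ℕ → ℕ
weight 1 = 2
weight 2 = 1
weight _ = 0

d*weight≤2 : ∀ d → d * weight d ≤ 2
d*weight≤2 0 = z≤n
d*weight≤2 1 = ≤-refl
d*weight≤2 2 = ≤-refl
d*weight≤2 d@(suc (suc (suc _))) = ≤-trans (≤-reflexive (*-zeroʳ d)) z≤n

weight-sum≥3 : ∀ {x y} → 1 ≤ x → 1 ≤ y → x + y ≤ 3 → 3 ≤ weight x + weight y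
weight-sum≥3 {1} {1} _ _ _ = s≤s (s≤s (s≤s z≤n))
weight-sum≥3 {1} {2} _ _ _ = ≤-refl
weight-sum≥3 {2} {1} _ _ _ = ≤-refl
weight-sum≥3 {1} {suc (suc (suc _))} _ _ (s≤s (s≤s (s≤s ())))
weight-sum≥3 {2} {suc (suc _)}       _ _ (s≤s (s≤s (s≤s ())))
weight-sum≥3 {suc (suc (suc x))} {suc y} _ _ (s≤s (s≤s (s≤s x+1+y≤0))) =
  ⊥-elim (m+1+n≢0 x (n≤0⇒n≡0 x+1+y≤0))

module _ {n : ℕ} (G : SimpleGraph n) where

  src<tgt : (e : Edge G) → src G e < tgt G e
  src<tgt (_ , _ , s<t , _) = s<t

  src≢tgt : (e : Edge G) → src G e ≢ tgt G e
  src≢tgt e s≡t = <-irrefl s≡t (src<tgt e)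

  edge-≡ : {e f : Edge G} → src G e ≡ src G f → tgt G e ≡ tgt G f → e ≡ f
  edge-≡ {i , j , i<j , ij} {.i , .j , i<j′ , ij′} refl refl =
    cong₂ (λ p q → i , j , p , q) (<-irrelevant i<j i<j′) (T-irrelevant ij ij′)

  _≟ₑ_ : DecidableEquality (Edge G)
  e ≟ₑ f with src G e ≟ src G f | tgt G e ≟ tgt G f
  ... | yes s≡ | yes t≡ = yes (edge-≡ s≡ t≡)
  ... | no  s≢ | _      = no (s≢ ∘ cong (src G))
  ... | yes _  | no t≢  = no (t≢ ∘ cong (tgt G))

  incidence : Edge G → Fin n → ℕ
  incidence e v = δ v (src G e) + δ v (tgt G e)

  degree : List (Edge G) → Fin n → ℕ
  degree S v = ∑[ e ∈ S ] incidence e v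

  incidence≤1 : (e : Edge G) (v : Fin n) → incidence e v ≤ 1
  incidence≤1 e v = δ+δ≤1 v (src≢tgt e)

  incidence-src : (e : Edge G) → incidence e (src G e) ≡ 1
  incidence-src e = cong₂ _+_ (δ-refl (src G e)) (δ-≢ (src≢tgt e))

  incidence-tgt : (e : Edge G) → incidence e (tgt G e) ≡ 1
  incidence-tgt e = cong₂ _+_ (δ-≢ (src≢tgt e ∘ ≡-sym)) (δ-refl (tgt G e))

  incidence≢0 : (e : Edge G) (v : Fin n) → incidence e v ≢ 0 → v ≡ src G e ⊎ v ≡ tgt G e
  incidence≢0 e v = Sum.map δ≢0⇒≡ δ≢0⇒≡ ∘ m+n≢0⇒m≢0⊎n≢0 _

  ∑-incidence : (H : Fin n → ℕ) (e : Edge G) →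
                ∑[ v ∈ allFin n ] incidence e v * H v ≡ H (src G e) + H (tgt G e)
  ∑-incidence H e = begin
      ∑[ v ∈ allFin n ] incidence e v * H v
    ≡⟨ ∑-cong (allFin n) (λ v → *-distribʳ-+ (H v) (δ v (src G e)) (δ v (tgt G e))) ⟩
      ∑[ v ∈ allFin n ] δ v (src G e) * H v + δ v (tgt G e) * H v
    ≡⟨ ∑-distrib-+ (allFin n) _ _ ⟩
      (∑[ v ∈ allFin n ] δ v (src G e) * H v) + (∑[ v ∈ allFin n ] δ v (tgt G e) * H v)
    ≡⟨ cong₂ _+_ (∑-δ H (allFin⁺ n) (∈-allFin _)) (∑-δ H (allFin⁺ n) (∈-allFin _)) ⟩
      H (src G e) + H (tgt G e)
    ∎
    where open ≡-Reasoning

  ∑-degree : (H : Fin n → ℕ) (S : List (Edge G)) →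
             ∑[ v ∈ allFin n ] degree S v * H v ≡ ∑[ e ∈ S ] H (src G e) + H (tgt G e)
  ∑-degree H []      = ∑-const (allFin n) 0
  ∑-degree H (e ∷ S) = begin
      ∑[ v ∈ allFin n ] (incidence e v + degree S v) * H v
    ≡⟨ ∑-cong (allFin n) (λ v → *-distribʳ-+ (H v) (incidence e v) (degree S v)) ⟩
      ∑[ v ∈ allFin n ] incidence e v * H v + degree S v * H v
    ≡⟨ ∑-distrib-+ (allFin n) _ _ ⟩
      (∑[ v ∈ allFin n ] incidence e v * H v) + (∑[ v ∈ allFin n ] degree S v * H v)
    ≡⟨ cong₂ _+_ (∑-incidence H e) (∑-degree H S) ⟩
      H (src G e) + H (tgt G e) + (∑[ f ∈ S ] H (src G f) + H (tgt G f))
    ∎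
    where open ≡-Reasoning

  meets : Edge G → Edge G → ℕ
  meets e f = incidence f (src G e) + incidence f (tgt G e)

  meets≤2 : (e f : Edge G) → meets e f ≤ 2
  meets≤2 e f = +-mono-≤ (incidence≤1 f (src G e)) (incidence≤1 f (tgt G e))

  meets≤1 : {e f : Edge G} → f ≢ e → meets e f ≤ 1
  meets≤1 {e} {f} f≢e = m+n≤1 (incidence≤1 f (src G e)) (incidence≤1 f (tgt G e)) λ s∈f t∈f →
    let s≡ , t≡ = ordered-pair-≡ (src<tgt e) (src<tgt f) (incidence≢0 f _ s∈f) (incidence≢0 f _ t∈f)
    in f≢e (edge-≡ (≡-sym s≡) (≡-sym t≡))

  meets≢0⇒ShareEnd : {e f : Edge G} → meets e f ≢ 0 → ShareEnd G e f
  meets≢0⇒ShareEnd {e} {f} = Sum.map (incidence≢0 f (src G e)) (incidence≢0 f (tgt G e)) ∘ m+n≢0⇒m≢0⊎n≢0 _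

  meets-diag meets-offdiag : Edge G → Edge G → ℕ
  meets-diag e f with f ≟ₑ e
  ... | yes _ = meets e f
  ... | no  _ = 0
  meets-offdiag e f with f ≟ₑ e
  ... | yes _ = 0
  ... | no  _ = meets e f

  meets-split : (e f : Edge G) → meets e f ≡ meets-diag e f + meets-offdiag e f
  meets-split e f with f ≟ₑ e
  ... | yes _ = ≡-sym (+-identityʳ (meets e f))
  ... | no  _ = refl

  meets-diag≤2 : (e f : Edge G) → meets-diag e f ≤ 2
  meets-diag≤2 e f with f ≟ₑ e
  ... | yes _ = meets≤2 e f
  ... | no  _ = z≤n

  meets-diag≢0 : {e f : Edge G} → meets-diag e f ≢ 0 → f ≡ e
  meets-diag≢0 {e} {f} ≢0 with f ≟ₑ e
  ... | yes f≡e = f≡e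
  ... | no  _   = ⊥-elim (≢0 refl)

  meets-offdiag≤1 : (e f : Edge G) → meets-offdiag e f ≤ 1
  meets-offdiag≤1 e f with f ≟ₑ e
  ... | yes _   = z≤n
  ... | no  f≢e = meets≤1 f≢e

  meets-offdiag≢0 : {e f : Edge G} → meets-offdiag e f ≢ 0 → Adj (LineGraph G) e f
  meets-offdiag≢0 {e} {f} ≢0 with f ≟ₑ e
  ... | yes _   = ⊥-elim (≢0 refl)
  ... | no  f≢e = (λ e≡f → f≢e (≡-sym e≡f)) , meets≢0⇒ShareEnd {e} {f} ≢0

  module _ {S : List (Edge G)} (S! : Unique S) (S≤1 : MaxDeg≤1 (LineGraph G) S) where

    -- e itself contributes 2, and the at most one other edge of S touching e contributes 1.
    degree-ends≤3 : {e : Edge G} → e ∈ S → degree S (src G e) + degree S (tgt G e) ≤ 3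
    degree-ends≤3 {e} e∈S = begin
        degree S (src G e) + degree S (tgt G e)
      ≡⟨ ∑-distrib-+ S _ _ ⟨
        ∑[ f ∈ S ] meets e f
      ≡⟨ ∑-cong S (meets-split e) ⟩
        ∑[ f ∈ S ] meets-diag e f + meets-offdiag e f
      ≡⟨ ∑-distrib-+ S _ _ ⟩
        ∑ S (meets-diag e) + ∑ S (meets-offdiag e)
      ≤⟨ +-mono-≤ diag≤2 offdiag≤1 ⟩
        3
      ∎
      where
      open ≤-Reasoning
      diag≤2 : ∑ S (meets-diag e) ≤ 2
      diag≤2 = ∑-≤-subsingleton S! (λ {f} _ → meets-diag≤2 e f)
        (λ _ _ p q → trans (meets-diag≢0 p) (≡-sym (meets-diag≢0 q)))
      offdiag≤1 : ∑ S (meets-offdiag e) ≤ 1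
      offdiag≤1 = ∑-≤-subsingleton S! (λ {f} _ → meets-offdiag≤1 e f)
        (λ f∈S g∈S p q → S≤1 e e∈S _ _ f∈S g∈S (meets-offdiag≢0 p) (meets-offdiag≢0 q))

    ∈⇒1≤degree : {e : Edge G} (v : Fin n) → e ∈ S → incidence e v ≡ 1 → 1 ≤ degree S v
    ∈⇒1≤degree v e∈S inc≡1 = subst (_≤ degree S v) inc≡1 (∈⇒≤∑ (λ f → incidence f v) e∈S)

    3*size≤2*order : 3 * length S ≤ 2 * n
    3*size≤2*order = begin
        3 * length S                                       ≡⟨ ∑-const S 3 ⟨
        ∑[ e ∈ S ] 3                                       ≤⟨ ∑-mono-≤ S charge≥3 ⟩
        ∑[ e ∈ S ] w (src G e) + w (tgt G e)               ≡⟨ ∑-degree w S ⟨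
        ∑[ v ∈ allFin n ] degree S v * w v                 ≤⟨ ∑-mono-≤ (allFin n) (λ {v} _ → d*weight≤2 (degree S v)) ⟩
        ∑[ v ∈ allFin n ] 2                                ≡⟨ ∑-const (allFin n) 2 ⟩
        2 * length (allFin n)                              ≡⟨ cong (2 *_) (length-tabulate {n = n} id) ⟩
        2 * n                                              ∎
      where
      open ≤-Reasoning
      w : Fin n → ℕ
      w v = weight (degree S v)
      charge≥3 : ∀ {e} → e ∈ S → 3 ≤ w (src G e) + w (tgt G e)
      charge≥3 {e} e∈S = weight-sum≥3 (∈⇒1≤degree (src G e) e∈S (incidence-src e))
                                      (∈⇒1≤degree (tgt G e) e∈S (incidence-tgt e))
                                      (degree-ends≤3 e∈S)

module _ (H : Graph) (x y : V H) where

  ∈-pair-not-adjacent-to-both : ∀ {v} → v ∈ x ∷ y ∷ [] → Adj H v x → Adj H v y → ⊥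
  ∈-pair-not-adjacent-to-both (here refl)         vx _  = Adj-irrefl H x vx
  ∈-pair-not-adjacent-to-both (there (here refl)) _  vy = Adj-irrefl H y vy

  MaxDeg≤1-pair : MaxDeg≤1 H (x ∷ y ∷ [])
  MaxDeg≤1-pair v v∈ u w u∈ w∈ vu vw with u∈ | w∈
  ... | here refl         | here refl         = refl
  ... | there (here refl) | there (here refl) = refl
  ... | here refl         | there (here refl) = ⊥-elim (∈-pair-not-adjacent-to-both v∈ vu vw)
  ... | there (here refl) | here refl         = ⊥-elim (∈-pair-not-adjacent-to-both v∈ vw vu)

path : (m : ℕ) → SimpleGraph m
path m = record
  { adj    = λ i j → consecutive i j ∨ consecutive j i
  ; sym    = λ i j → ∨-comm (consecutive i j) (consecutive j i)
  ; irrefl = λ i → cong₂ _∨_ (not-consecutive-self i) (not-consecutive-self i)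
  }
  where
  consecutive : Fin m → Fin m → Bool
  consecutive i j = does (suc (toℕ i) ℕ.≟ toℕ j)
  not-consecutive-self : ∀ i → consecutive i i ≡ false
  not-consecutive-self i = dec-false (suc (toℕ i) ℕ.≟ toℕ i) 1+n≢n

-- Vertex v of the k-fold copy is vertex i of copy p, where remQuot k v = (i , p).
copies : {m : ℕ} (k : ℕ) → SimpleGraph m → SimpleGraph (m * k)
copies {m} k H = record
  { adj    = λ v w → adjᶜ (remQuot {m} k v) (remQuot {m} k w)
  ; sym    = λ v w → adjᶜ-sym (remQuot {m} k v) (remQuot {m} k w)
  ; irrefl = λ v → adjᶜ-irrefl (remQuot {m} k v)
  }
  where
  adjᶜ : Fin m × Fin k → Fin m × Fin k → Bool
  adjᶜ (i , p) (j , q) = does (p ≟ q) ∧ adj H i j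
  adjᶜ-sym : ∀ x y → adjᶜ x y ≡ adjᶜ y x
  adjᶜ-sym (i , p) (j , q) = cong₂ _∧_ (does-≟-comm p q) (sym H i j)
  adjᶜ-irrefl : ∀ x → adjᶜ x x ≡ false
  adjᶜ-irrefl (i , p) = trans (cong (does (p ≟ p) ∧_) (irrefl H i)) (∧-zeroʳ (does (p ≟ p)))

module _ {m : ℕ} (k : ℕ) (H : SimpleGraph m) where

  adj-copies-combine : (i j : Fin m) (p q : Fin k) →
                       adj (copies k H) (combine i p) (combine j q) ≡ does (p ≟ q) ∧ adj H i j
  adj-copies-combine i j p q =
    cong₂ (λ x y → does (proj₂ x ≟ proj₂ y) ∧ adj H (proj₁ x) (proj₁ y)) (remQuot-combine i p) (remQuot-combine j q)

  lift-adj : (e : Edge H) (q : Fin k) → T (adj (copies k H) (combine (src H e) q) (combine (tgt H e) q))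
  lift-adj (i , j , _ , ij) q =
    subst T (≡-sym (trans (adj-copies-combine i j q q) (cong (_∧ adj H i j) (dec-true (q ≟ q) refl)))) ij

  lift : Edge H → Fin k → Edge (copies k H)
  lift e q = combine (src H e) q , combine (tgt H e) q , combine-monoˡ-< q q (src<tgt H e) , lift-adj e q

  lift-injective : ∀ {e f : Edge H} {p q : Fin k} → lift e p ≡ lift f q → e ≡ f × p ≡ q
  lift-injective eq =
    let s≡ , p≡q = combine-injective _ _ _ _ (cong proj₁ eq)
        t≡ , _   = combine-injective _ _ _ _ (cong (proj₁ ∘ proj₂) eq)
    in edge-≡ H s≡ t≡ , p≡q

  ShareEnd-lift⁻ : ∀ {e f : Edge H} {p q : Fin k} →
                   ShareEnd (copies k H) (lift e p) (lift f q) → ShareEnd H e f × p ≡ q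
  ShareEnd-lift⁻ sh = Sum.map (Sum.map position≡ position≡) (Sum.map position≡ position≡) sh
                    , [ [ copy≡ , copy≡ ]′ , [ copy≡ , copy≡ ]′ ]′ sh
    where
    position≡ : ∀ {i j : Fin m} {p q : Fin k} → combine i p ≡ combine j q → i ≡ j
    position≡ {i} {j} {p} {q} = proj₁ ∘ combine-injective i p j q
    copy≡ : ∀ {i j : Fin m} {p q : Fin k} → combine i p ≡ combine j q → p ≡ q
    copy≡ {i} {j} {p} {q} = proj₂ ∘ combine-injective i p j q

  Adj-lift⁻ : ∀ {e f : Edge H} {p q : Fin k} →
              Adj (LineGraph (copies k H)) (lift e p) (lift f q) → Adj (LineGraph H) e f × p ≡ q
  Adj-lift⁻ {e} {f} {p} {q} (lift≢ , sh) =
    let sh′ , p≡q = ShareEnd-lift⁻ {e} {f} {p} {q} sh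
    in ((λ e≡f → lift≢ (cong₂ lift e≡f p≡q)) , sh′) , p≡q

  lifts : List (Edge H) → List (Edge (copies k H))
  lifts E = cartesianProductWith lift E (allFin k)

  lifts-unique : {E : List (Edge H)} → Unique E → Unique (lifts E)
  lifts-unique E! = cartesianProductWith⁺ lift lift-injective E! (allFin⁺ k)

  lifts-length : (E : List (Edge H)) → length (lifts E) ≡ length E * k
  lifts-length E = trans (length-cartesianProductWith lift E (allFin k)) (cong (length E *_) (length-tabulate {n = k} id))

  lifts-MaxDeg≤1 : {E : List (Edge H)} → MaxDeg≤1 (LineGraph H) E → MaxDeg≤1 (LineGraph (copies k H)) (lifts E)
  lifts-MaxDeg≤1 {E} E≤1 v v∈ u w u∈ w∈ vu vw
    with ∈-cartesianProductWith⁻ lift E (allFin k) v∈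
       | ∈-cartesianProductWith⁻ lift E (allFin k) u∈
       | ∈-cartesianProductWith⁻ lift E (allFin k) w∈
  ... | e , p , e∈ , _ , refl | f , q , f∈ , _ , refl | g , r , g∈ , _ , refl
    with Adj-lift⁻ {e} {f} {p} {q} vu | Adj-lift⁻ {e} {g} {p} {r} vw
  ... | ef , refl | eg , refl = cong (λ h → lift h p) (E≤1 e e∈ f g f∈ g∈ ef eg)

P₃ : SimpleGraph 3
P₃ = path 3

P₃-edge₀₁ P₃-edge₁₂ : Edge P₃
P₃-edge₀₁ = zero , suc zero , s≤s z≤n , _
P₃-edge₁₂ = suc zero , suc (suc zero) , s≤s (s≤s z≤n) , _

P₃-edges : List (Edge P₃)
P₃-edges = P₃-edge₀₁ ∷ P₃-edge₁₂ ∷ []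

P₃-edges-unique : Unique P₃-edges
P₃-edges-unique = ((λ ()) ∷ []) ∷ [] ∷ []

α₁-copies-P₃ : (k : ℕ) → IsAlpha1 (LineGraph (copies k P₃)) (2 * k)
α₁-copies-P₃ k =
    ( lifts k P₃ P₃-edges
    , lifts-unique k P₃ P₃-edges-unique
    , lifts-MaxDeg≤1 k P₃ (MaxDeg≤1-pair (LineGraph P₃) P₃-edge₀₁ P₃-edge₁₂)
    , lifts-length k P₃ P₃-edges )
  , λ S S! S≤1 → *-cancelˡ-≤ 3 (subst (3 * length S ≤_) 2*[3*k]≡3*[2*k] (3*size≤2*order (copies k P₃) S! S≤1))
  where
  2*[3*k]≡3*[2*k] : 2 * (3 * k) ≡ 3 * (2 * k)
  2*[3*k]≡3*[2*k] = trans (≡-sym (*-assoc 2 3 k)) (*-assoc 3 2 k)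

lemma5 : ((n : ℕ) (G : SimpleGraph n) (m : ℕ) →
             IsAlpha1 (LineGraph G) m → 3 * m ≤ 2 * n)
           × ((k : ℕ) → Σ (SimpleGraph (3 * k)) (λ G → IsAlpha1 (LineGraph G) (2 * k)))
lemma5 = (λ n G m ((S , S! , S≤1 , |S|≡m) , _) → subst (λ s → 3 * s ≤ 2 * n) |S|≡m (3*size≤2*order G S! S≤1))
       , (λ k → copies k P₃ , α₁-copies-P₃ k)
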